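{- Let $r\ge2$ and $m\ge3$ be integers, and let $A$ be a simple $m$-rowed $r$-matrix that avoids $I_2$. Let $T_A$ be a tournament associated with $A$. If $T_A$ is not transitive, then \[|A|\le m(r-1)^{m-1}+(r-1)^m-2(r-1)^{m-3}.\]
   Context: An $r$-matrix is a matrix with entries in $\{0,1,\dots,r-1\}$. A matrix is simple if it has no repeated columns. $I_2$ is the $2\times2$ identity matrix; $A$ avoids $I_2$ if no submatrix of $A$ is a row and column permutation of $I_2$. $|A|$ is the number of columns of $A$. A tournament associated with $A$ is a tournament $T_A$ on the vertex set of rows $\{1,\dots,m\}$ in which, for each pair $i\ne j$, the edge is directed from $i$ to $j$ only if there is no column of $A$ with $0$ in row $i$ and $1$ in row $j$ (if both directions are permissible, one is chosen arbitrarily; since $A$ avoids $I_2$, at least one direction is always permissible). -}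

module Defs where

open import Data.Nat using (ℕ; zero; suc; _+_; _*_; _∸_; _^_; _≤_)
open import Data.Fin using (Fin; toℕ)
open import Data.Vec using (Vec; lookup)
open import Data.List using (List; length)
import Data.List as L
open import Data.List.Relation.Unary.Unique.Propositional using (Unique)
open import Data.Product using (Σ; ∃; _×_; _,_)
open import Data.Sum using (_⊎_)
open import Data.Empty using (⊥)
open import Relation.Nullary using (¬_)
open import Relation.Binary.PropositionalEquality using (_≡_; _≢_)

Column : ℕ → ℕ → Set
Column r m = Vec (Fin r) m

Matrix : ℕ → ℕ → Set
Matrix r m = List (Column r m)

ncols : ∀ {r m} → Matrix r m → ℕ
ncols A = length A

entry : ∀ {r m} (A : Matrix r m) → Fin m → Fin (length A) → ℕ
entry A i c = toℕ (lookup (L.lookup A c) i)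

Simple : ∀ {r m} → Matrix r m → Set
Simple A = Unique A

-- A contains I₂: rows i ≠ j, columns c ≠ d whose 2×2 submatrix is
-- (up to row and column permutation) the identity [[1,0],[0,1]].
ContainsI₂ : ∀ {r m} → Matrix r m → Set
ContainsI₂ {r} {m} A =
  Σ (Fin m) λ i → Σ (Fin m) λ j → Σ (Fin (length A)) λ c → Σ (Fin (length A)) λ d →
    (i ≢ j) × (c ≢ d) ×
    (entry A i c ≡ 1) × (entry A j c ≡ 0) × (entry A i d ≡ 0) × (entry A j d ≡ 1)

AvoidsI₂ : ∀ {r m} → Matrix r m → Set
AvoidsI₂ A = ¬ ContainsI₂ A

record IsTournament {m : ℕ} (T : Fin m → Fin m → Set) : Set where
  field
    irrefl   : ∀ i → ¬ T i i
    total    : ∀ i j → i ≢ j → T i j ⊎ T j i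
    asym     : ∀ i j → T i j → ¬ T j i

IsAssociatedTournament : ∀ {r m} → Matrix r m → (Fin m → Fin m → Set) → Set
IsAssociatedTournament {r} {m} A T =
  IsTournament T ×
  (∀ i j → T i j → ¬ (Σ (Fin (length A)) λ c → (entry A i c ≡ 0) × (entry A j c ≡ 1)))

Transitive : ∀ {m} → (Fin m → Fin m → Set) → Set
Transitive {m} T = ∀ i j k → T i j → T j k → T i k

module Submission where

-- Write s = r - 1 and m = 3 + k.  The columns of A are distinct words
-- of length m over {0,…,r-1}, and every column is compatible with the relation
-- "Permitted A" of directions i → j along which no column has 0 at i and 1 at j.
-- This relation is decidable, contains T_A (hence any two rows are related in some
-- direction), and, because T_A is a tournament that is not transitive, it contains a
-- directed triangle.  So it suffices to bound the number of words compatible with a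
-- complete relation containing a directed triangle:
--   * after relabelling the rows by a permutation the triangle sits on the last
--     three rows;
--   * for three rows forming a triangle there are s³ + 3s² - 2 compatible words;
--   * deleting a row outside the triangle multiplies the count by at most s and
--     adds at most s ^ (number of remaining rows).
-- By induction, count + 2 s^k ≤ m s^(m-1) + s^m, which gives the theorem.

open import Defs
open import Data.Nat using (ℕ; zero; suc; _+_; _*_; _∸_; _^_; _≤_; z≤n; s≤s)
open import Data.Nat.Properties
  using (≤-refl; ≤-trans; ≤-reflexive; +-mono-≤; +-monoˡ-≤; +-monoʳ-≤; *-monoʳ-≤; *-zeroʳ; +-assoc;
         m+n≤o⇒m≤o∸n; +-0-commutativeMonoid; module ≤-Reasoning)
import Data.Nat.Properties as ℕ
open import Data.Nat.Tactic.RingSolver using (solve-∀)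
open import Data.Fin using (Fin; zero; suc; toℕ)
open import Data.Fin.Patterns using (0F; 1F; 2F)
open import Data.Fin.Properties using (0≢1+n; suc-injective; all?; any?) renaming (_≟_ to _≟ᶠ_)
open import Data.Fin.Permutation using (Permutation′; _⟨$⟩ʳ_; _⟨$⟩ˡ_; inverseˡ; inverseʳ; transpose; _∘ₚ_; flip)
  renaming (id to idₚ)
import Data.Fin.Permutation.Components as Transposition
open import Data.Vec using ([]; _∷_; lookup; tabulate)
open import Data.Vec.Properties using (lookup∘tabulate; tabulate∘lookup; tabulate-cong)
open import Data.List using (List; length; map; _++_) renaming ([] to []ᴸ; _∷_ to _∷ᴸ_)
open import Data.List.Properties using (length-++; length-map; length-removeAt′)
open import Data.List.Membership.Propositional using (_∈_)
open import Data.List.Membership.Propositional.Properties using (∈-map⁺; ∈-map⁻; ∈-++⁺ˡ; ∈-++⁺ʳ)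
open import Data.List.Relation.Unary.Any using (here; there; index; _─_)
open import Data.List.Relation.Unary.Any.Properties using (lookup-index)
open import Data.List.Relation.Binary.Subset.Propositional using (_⊆_)
open import Data.List.Relation.Unary.AllPairs using (_∷_)
import Data.List.Relation.Unary.All as All
open import Data.List.Relation.Unary.Unique.Propositional using (Unique)
import Data.List.Relation.Unary.Unique.Propositional.Properties as Unique
open import Data.Product using (Σ; ∃; _×_; _,_)
open import Data.Sum using (_⊎_; inj₁; inj₂)
import Data.Sum as Sum
open import Data.Bool using (if_then_else_)
open import Data.Empty using (⊥-elim)
open import Function using (_∘_; _on_)
open import Function.Definitions using (Injective)
open import Relation.Nullary using (¬_; Dec; yes; no; does)
open import Relation.Nullary.Decidable using (_×-dec_; _→-dec_; ¬?; dec-true; dec-false)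
open import Relation.Unary using (Decidable)
open import Relation.Binary.PropositionalEquality using (_≡_; _≢_; refl; sym; trans; cong; subst; subst₂)
open import Algebra.Properties.CommutativeMonoid.Sum +-0-commutativeMonoid using (sum; ∑-distrib-+; sum-cong-≗)

∑-mono : ∀ {k} {f g : Fin k → ℕ} → (∀ a → f a ≤ g a) → sum f ≤ sum g
∑-mono {zero}  f≤g = z≤n
∑-mono {suc k} f≤g = +-mono-≤ (f≤g zero) (∑-mono (λ a → f≤g (suc a)))

∑-bounded : ∀ {k B} {f : Fin k → ℕ} → (∀ a → f a ≤ B) → sum f ≤ k * B
∑-bounded {zero}  f≤B = z≤n
∑-bounded {suc k} f≤B = +-mono-≤ (f≤B zero) (∑-bounded (λ a → f≤B (suc a)))

∑-bounded-except : ∀ {p B} {f : Fin (suc p) → ℕ} (x : Fin (suc p)) →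
                   f x ≤ 0 → (∀ a → a ≢ x → f a ≤ B) → sum f ≤ p * B
∑-bounded-except zero fx≤0 f≤B = +-mono-≤ fx≤0 (∑-bounded (λ a → f≤B (suc a) (λ ())))
∑-bounded-except {suc p} (suc x) fx≤0 f≤B =
  +-mono-≤ (f≤B zero 0≢1+n) (∑-bounded-except x fx≤0 (λ a a≢x → f≤B (suc a) (λ e → a≢x (suc-injective e))))

∈-─ : ∀ {A : Set} {x y : A} {ys : List A} (x∈ys : x ∈ ys) → y ∈ ys → y ≢ x → y ∈ (ys ─ x∈ys)
∈-─ (here refl) (here y≡x)  y≢x = ⊥-elim (y≢x y≡x)
∈-─ (here refl) (there y∈)  y≢x = y∈
∈-─ (there x∈)  (here y≡z)  y≢x = here y≡z
∈-─ (there x∈)  (there y∈)  y≢x = there (∈-─ x∈ y∈ y≢x)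

unique-⊆⇒length≤ : ∀ {A : Set} {xs ys : List A} → Unique xs → xs ⊆ ys → length xs ≤ length ys
unique-⊆⇒length≤ {xs = []ᴸ} _ _ = z≤n
unique-⊆⇒length≤ {xs = x ∷ᴸ xs} {ys} (x∉xs ∷ unique) xs⊆ys = begin
  suc (length xs)          ≤⟨ s≤s (unique-⊆⇒length≤ unique xs⊆ys─x) ⟩
  suc (length (ys ─ x∈ys)) ≡⟨ sym (length-removeAt′ ys (index x∈ys)) ⟩
  length ys                ∎
  where
    open ≤-Reasoning
    x∈ys : x ∈ ys
    x∈ys = xs⊆ys (here refl)
    xs⊆ys─x : xs ⊆ (ys ─ x∈ys)
    xs⊆ys─x y∈xs = ∈-─ x∈ys (xs⊆ys (there y∈xs)) (λ y≡x → All.lookup x∉xs y∈xs (sym y≡x))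

concatFin : ∀ {A : Set} {k} → (Fin k → List A) → List A
concatFin {k = zero}  f = []ᴸ
concatFin {k = suc k} f = f zero ++ concatFin (λ a → f (suc a))

length-concatFin : ∀ {A : Set} {k} (f : Fin k → List A) → length (concatFin f) ≡ sum (λ a → length (f a))
length-concatFin {k = zero}  f = refl
length-concatFin {k = suc k} f =
  trans (length-++ (f zero)) (cong (length (f zero) +_) (length-concatFin (λ a → f (suc a))))

∈-concatFin : ∀ {A : Set} {k} {x : A} (f : Fin k → List A) a → x ∈ f a → x ∈ concatFin f
∈-concatFin {k = suc k} f zero    x∈ = ∈-++⁺ˡ x∈
∈-concatFin {k = suc k} f (suc a) x∈ = ∈-++⁺ʳ (f zero) (∈-concatFin (λ b → f (suc b)) a x∈)

-- The number is kept
-- opaque; only the lemmas of this block look inside it, which keeps type checking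
-- from unfolding it in the rest of the file.

opaque
  count : ∀ {q n} {P : Column q n → Set} → Decidable P → ℕ
  count {n = zero} P? with P? []
  ... | yes _ = 1
  ... | no  _ = 0
  count {q} {suc n} P? = sum {q} (λ a → count (λ w → P? (a ∷ w)))

  solutions : ∀ {q n} {P : Column q n → Set} → Decidable P → List (Column q n)
  solutions {n = zero} P? with P? []
  ... | yes _ = [] ∷ᴸ []ᴸ
  ... | no  _ = []ᴸ
  solutions {n = suc n} P? = concatFin (λ a → map (a ∷_) (solutions (λ w → P? (a ∷ w))))

  length-solutions : ∀ {q n} {P : Column q n → Set} (P? : Decidable P) → length (solutions P?) ≡ count P?
  length-solutions {n = zero} P? with P? []
  ... | yes _ = refl
  ... | no  _ = refl
  length-solutions {n = suc n} P? =
    trans (length-concatFin (λ a → map (a ∷_) (solutions (λ w → P? (a ∷ w))))) (sum-cong-≗ λ a →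
      trans (length-map (a ∷_) (solutions (λ w → P? (a ∷ w)))) (length-solutions (λ w → P? (a ∷ w))))

  ∈-solutions : ∀ {q n} {P : Column q n → Set} (P? : Decidable P) {v} → P v → v ∈ solutions P?
  ∈-solutions {n = zero} P? {[]} Pv with P? []
  ... | yes _  = here refl
  ... | no ¬Pv = ⊥-elim (¬Pv Pv)
  ∈-solutions {n = suc n} P? {a ∷ w} Pv =
    ∈-concatFin _ a (∈-map⁺ (a ∷_) (∈-solutions (λ w → P? (a ∷ w)) Pv))

  count-by-first-letter : ∀ {t n B C} {P : Column (2 + t) (suc n) → Set} (P? : Decidable P) →
                          count (λ w → P? (0F ∷ w)) + count (λ w → P? (1F ∷ w)) ≤ B →
                          (∀ b → count (λ w → P? (suc (suc b) ∷ w)) ≤ C) → count P? ≤ B + t * C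
  count-by-first-letter {t} P? first-two≤B others≤C =
    ≤-trans (≤-reflexive (sym (+-assoc (slice 0F) (slice 1F) (sum (λ b → slice (suc (suc b)))))))
            (+-mono-≤ first-two≤B (∑-bounded others≤C))
    where
      slice : Fin (2 + t) → ℕ
      slice a = count (λ w → P? (a ∷ w))

  count-mono : ∀ {q n} {P Q : Column q n → Set} (P? : Decidable P) (Q? : Decidable Q) →
               (∀ v → P v → Q v) → count P? ≤ count Q?
  count-mono {n = zero} P? Q? P⇒Q with P? [] | Q? []
  ... | yes Pv | yes _  = ≤-refl
  ... | yes Pv | no ¬Qv = ⊥-elim (¬Qv (P⇒Q [] Pv))
  ... | no _   | _      = z≤n
  count-mono {n = suc n} P? Q? P⇒Q =
    ∑-mono (λ a → count-mono (λ w → P? (a ∷ w)) (λ w → Q? (a ∷ w)) (λ w → P⇒Q (a ∷ w)))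

  count-empty : ∀ {q n} {P : Column q n → Set} (P? : Decidable P) → (∀ v → ¬ P v) → count P? ≤ 0
  count-empty {n = zero} P? ¬P with P? []
  ... | yes P[] = ⊥-elim (¬P [] P[])
  ... | no  _   = z≤n
  count-empty {q} {suc n} P? ¬P =
    ≤-trans (∑-bounded (λ a → count-empty (λ w → P? (a ∷ w)) (λ w → ¬P (a ∷ w)))) (≤-reflexive (*-zeroʳ q))

  count-≤-power : ∀ {q n} {P : Column q n → Set} (P? : Decidable P) → count P? ≤ q ^ n
  count-≤-power {n = zero} P? with P? []
  ... | yes _ = ≤-refl
  ... | no  _ = z≤n
  count-≤-power {n = suc n} P? = ∑-bounded (λ a → count-≤-power (λ w → P? (a ∷ w)))

  count-+ : ∀ {q n} {P Q C D : Column q n → Set}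
            (P? : Decidable P) (Q? : Decidable Q) (C? : Decidable C) (D? : Decidable D) →
            (∀ v → P v → C v) → (∀ v → Q v → C v) → (∀ v → P v → Q v → D v) →
            count P? + count Q? ≤ count C? + count D?
  count-+ {n = zero} P? Q? C? D? P⇒C Q⇒C PQ⇒D with P? [] | Q? [] | C? [] | D? []
  ... | no _   | no _   | _      | _      = z≤n
  ... | yes Pv | _      | no ¬Cv | _      = ⊥-elim (¬Cv (P⇒C [] Pv))
  ... | _      | yes Qv | no ¬Cv | _      = ⊥-elim (¬Cv (Q⇒C [] Qv))
  ... | yes Pv | yes Qv | yes _  | no ¬Dv = ⊥-elim (¬Dv (PQ⇒D [] Pv Qv))
  ... | yes _  | yes _  | yes _  | yes _  = ≤-refl
  ... | yes _  | no _   | yes _  | _      = s≤s z≤n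
  ... | no _   | yes _  | yes _  | _      = s≤s z≤n
  count-+ {q} {suc n} P? Q? C? D? P⇒C Q⇒C PQ⇒D = begin
    sum count-P + sum count-Q           ≡⟨ sym (∑-distrib-+ count-P count-Q) ⟩
    sum (λ a → count-P a + count-Q a)   ≤⟨ ∑-mono (λ a → count-+ (λ w → P? (a ∷ w)) (λ w → Q? (a ∷ w))
                                                     (λ w → C? (a ∷ w)) (λ w → D? (a ∷ w))
                                                     (λ w → P⇒C (a ∷ w)) (λ w → Q⇒C (a ∷ w))
                                                     (λ w → PQ⇒D (a ∷ w))) ⟩
    sum (λ a → count-C a + count-D a)   ≡⟨ ∑-distrib-+ count-C count-D ⟩
    sum count-C + sum count-D           ∎
    where
      open ≤-Reasoning
      count-P count-Q count-C count-D : Fin q → ℕ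
      count-P a = count (λ w → P? (a ∷ w))
      count-Q a = count (λ w → Q? (a ∷ w))
      count-C a = count (λ w → C? (a ∷ w))
      count-D a = count (λ w → D? (a ∷ w))

  count-avoiding : ∀ {p n} {P : Column (suc p) n → Set} (P? : Decidable P) (φ : Fin n → Fin (suc p)) →
                   (∀ v → P v → ∀ i → lookup v i ≢ φ i) → count P? ≤ p ^ n
  count-avoiding {n = zero} P? φ avoids with P? []
  ... | yes _ = ≤-refl
  ... | no  _ = z≤n
  count-avoiding {n = suc n} P? φ avoids = ∑-bounded-except (φ zero)
    (count-empty (λ w → P? (φ zero ∷ w)) (λ w Pv → avoids (φ zero ∷ w) Pv zero refl))
    (λ a _ → count-avoiding (λ w → P? (a ∷ w)) (λ i → φ (suc i)) (λ w Pv i → avoids (a ∷ w) Pv (suc i)))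

unique⇒length≤count : ∀ {q n} {P : Column q n → Set} (P? : Decidable P) (L : List (Column q n)) →
                       Unique L → (∀ {v} → v ∈ L → P v) → length L ≤ count P?
unique⇒length≤count P? L unique L⊆P =
  ≤-trans (unique-⊆⇒length≤ unique (λ v∈L → ∈-solutions P? (L⊆P v∈L))) (≤-reflexive (length-solutions P?))

Compatible : ∀ {q n} → (Fin n → Fin n → Set) → Column q n → Set
Compatible R v = ∀ i j → R i j → ¬ (toℕ (lookup v i) ≡ 0 × toℕ (lookup v j) ≡ 1)

compatible? : ∀ {q n} {R : Fin n → Fin n → Set} → (∀ i j → Dec (R i j)) → Decidable (Compatible {q} R)
compatible? R? v =
  all? λ i → all? λ j → R? i j →-dec ¬? ((toℕ (lookup v i) ℕ.≟ 0) ×-dec (toℕ (lookup v j) ℕ.≟ 1))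

Complete : ∀ {n} → (Fin n → Fin n → Set) → Set
Complete R = ∀ i j → i ≢ j → R i j ⊎ R j i

delete₀ : ∀ {n} → (Fin (suc n) → Fin (suc n) → Set) → Fin n → Fin n → Set
delete₀ R i j = R (suc i) (suc j)

delete₀? : ∀ {n} {R : Fin (suc n) → Fin (suc n) → Set} → (∀ i j → Dec (R i j)) → ∀ i j → Dec (delete₀ R i j)
delete₀? R? i j = R? (suc i) (suc j)

regroup : ∀ t x y → (x + y) + t * x ≡ (1 + t) * x + y
regroup = solve-∀

-- Deleting vertex 0 costs at most a factor r - 1 plus (r - 1) ^ n: a word starting with
-- any letter restricts to a compatible word, and a word w that extends compatibly by
-- both 0 and 1 must avoid, at each i, the letter forced by the edge between 0 and i + 1.
delete-vertex : ∀ {t n} {R : Fin (suc n) → Fin (suc n) → Set} (R? : ∀ i j → Dec (R i j)) → Complete R →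
                count (compatible? {2 + t} R?)
                  ≤ (1 + t) * count (compatible? {2 + t} (delete₀? R?)) + (1 + t) ^ n
delete-vertex {t} {n} {R} R? complete =
  ≤-trans (count-by-first-letter (compatible? R?) first-two the-others) (≤-reflexive (regroup t c ((1 + t) ^ n)))
  where
    C? : Decidable (Compatible {2 + t} (delete₀ R))
    C? = compatible? (delete₀? R?)
    c : ℕ
    c = count C?

    restricts : ∀ a w → Compatible R (a ∷ w) → Compatible (delete₀ R) w
    restricts a w compat i j Rij = compat (suc i) (suc j) Rij

    -- the letter that w may not carry at i if both 0 ∷ w and 1 ∷ w are compatible
    φ : Fin n → Fin (2 + t)
    φ i = if does (R? 0F (suc i)) then 1F else 0F
    Avoids : Column (2 + t) n → Set
    Avoids w = ∀ i → lookup w i ≢ φ i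
    avoids? : Decidable Avoids
    avoids? w = all? λ i → ¬? (lookup w i ≟ᶠ φ i)

    both⇒avoids : ∀ w → Compatible R (0F ∷ w) → Compatible R (1F ∷ w) → Avoids w
    both⇒avoids w compat₀ compat₁ i with R? 0F (suc i)
    ... | yes R0i = λ wi≡1 → compat₀ 0F (suc i) R0i (refl , cong toℕ wi≡1)
    ... | no ¬R0i with complete (suc i) 0F (λ ())
    ...   | inj₁ Ri0 = λ wi≡0 → compat₁ (suc i) 0F Ri0 (cong toℕ wi≡0 , refl)
    ...   | inj₂ R0i = ⊥-elim (¬R0i R0i)

    first-two : count (λ w → compatible? R? (0F ∷ w)) + count (λ w → compatible? R? (1F ∷ w)) ≤ c + (1 + t) ^ n
    first-two = ≤-trans
      (count-+ (λ w → compatible? R? (0F ∷ w)) (λ w → compatible? R? (1F ∷ w)) C? avoids?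
               (restricts 0F) (restricts 1F) both⇒avoids)
      (+-monoʳ-≤ c (count-avoiding avoids? φ (λ w avoids → avoids)))

    the-others : ∀ b → count (λ w → compatible? R? (suc (suc b) ∷ w)) ≤ c
    the-others b = count-mono _ C? (restricts (suc (suc b)))

three-vertex-identity : ∀ t →
  ((((1 + t) * 1 + 0) + t * ((2 + t) * 1))
   + ((((0 + 0) + t * 1) + (1 + t) * 1) + t * ((1 + t) * 1))
   + t * (((1 + t) * 1 + (2 + t) * 1) + t * ((2 + t) * 1))) + 2
  ≡ 3 * ((1 + t) * ((1 + t) * 1)) + (1 + t) * ((1 + t) * ((1 + t) * 1))
three-vertex-identity = solve-∀

-- Splitting by the first two letters, each
-- slice is empty, unconstrained, or forbids one letter at the last position.
triangle-count : ∀ {t} {R : Fin 3 → Fin 3 → Set} (R? : ∀ i j → Dec (R i j)) →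
                 R 0F 1F → R 1F 2F → R 2F 0F →
                 count (compatible? {2 + t} R?) + 2 ≤ 3 * (1 + t) ^ 2 + (1 + t) ^ 3
triangle-count {t} {R} R? R01 R12 R20 = begin
  count (compatible? R?) + 2     ≤⟨ +-monoˡ-≤ 2 (count-by-first-letter (compatible? R?)
                                                   (+-mono-≤ first-0 first-1) first-≥2) ⟩
  _                              ≡⟨ three-vertex-identity t ⟩
  3 * (1 + t) ^ 2 + (1 + t) ^ 3  ∎
  where
    open ≤-Reasoning
    C? : Decidable (Compatible {2 + t} R)
    C? = compatible? R?

    -- first letter 0: the second letter is not 1 (edge 0 → 1); a second letter 0
    -- forbids a last letter 1 (edge 1 → 2)
    first-0 : count (λ w → C? (0F ∷ w)) ≤ ((1 + t) ^ 1 + 0) + t * (2 + t) ^ 1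
    first-0 = count-by-first-letter (λ w → C? (0F ∷ w))
      (+-mono-≤
        (count-avoiding (λ w → C? (0F ∷ 0F ∷ w)) (λ _ → 1F)
          (λ { (z ∷ []) compat 0F refl → compat 1F 2F R12 (refl , refl) }))
        (count-empty (λ w → C? (0F ∷ 1F ∷ w)) (λ w compat → compat 0F 1F R01 (refl , refl))))
      (λ b → count-≤-power (λ w → C? (0F ∷ suc (suc b) ∷ w)))

    -- first letter 1: the last letter is not 0 (edge 2 → 0); a second letter 0
    -- also forbids a last letter 1 (edge 1 → 2)
    first-1 : count (λ w → C? (1F ∷ w)) ≤ (((0 + 0) + t * (2 + t) ^ 0) + (1 + t) ^ 1) + t * (1 + t) ^ 1
    first-1 = count-by-first-letter (λ w → C? (1F ∷ w))
      (+-mono-≤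
        (count-by-first-letter (λ w → C? (1F ∷ 0F ∷ w))
          (+-mono-≤
            (count-empty (λ w → C? (1F ∷ 0F ∷ 0F ∷ w)) (λ w compat → compat 2F 0F R20 (refl , refl)))
            (count-empty (λ w → C? (1F ∷ 0F ∷ 1F ∷ w)) (λ w compat → compat 1F 2F R12 (refl , refl))))
          (λ b → count-≤-power (λ w → C? (1F ∷ 0F ∷ suc (suc b) ∷ w))))
        (count-avoiding (λ w → C? (1F ∷ 1F ∷ w)) (λ _ → 0F)
          (λ { (z ∷ []) compat 0F refl → compat 2F 0F R20 (refl , refl) })))
      (λ b → count-avoiding (λ w → C? (1F ∷ suc (suc b) ∷ w)) (λ _ → 0F)
        (λ { (z ∷ []) compat 0F refl → compat 2F 0F R20 (refl , refl) }))

    -- first letter ≥ 2: only a second letter 0 constrains, forbidding a last letter 1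
    first-≥2 : ∀ a → count (λ w → C? (suc (suc a) ∷ w)) ≤ ((1 + t) ^ 1 + (2 + t) ^ 1) + t * (2 + t) ^ 1
    first-≥2 a = count-by-first-letter (λ w → C? (suc (suc a) ∷ w))
      (+-mono-≤
        (count-avoiding (λ w → C? (suc (suc a) ∷ 0F ∷ w)) (λ _ → 1F)
          (λ { (z ∷ []) compat 0F refl → compat 1F 2F R12 (refl , refl) }))
        (count-≤-power (λ w → C? (suc (suc a) ∷ 1F ∷ w))))
      (λ b → count-≤-power (λ w → C? (suc (suc a) ∷ suc (suc b) ∷ w)))

-- The last three vertices of Fin (3 + k); for k > 0 vertex 0 is not among them.
last-three : ∀ k → Fin 3 → Fin (3 + k)
last-three zero    i = i
last-three (suc k) i = suc (last-three k i)

step-identity₁ : ∀ t c X → ((1 + t) * c + (1 + t) * ((1 + t) * ((1 + t) * X))) + 2 * ((1 + t) * X)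
                           ≡ (1 + t) * (c + 2 * X) + (1 + t) * ((1 + t) * ((1 + t) * X))
step-identity₁ = solve-∀

step-identity₂ : ∀ t k X →
  (1 + t) * ((3 + k) * ((1 + t) * ((1 + t) * X)) + (1 + t) * ((1 + t) * ((1 + t) * X)))
    + (1 + t) * ((1 + t) * ((1 + t) * X))
  ≡ (4 + k) * ((1 + t) * ((1 + t) * ((1 + t) * X))) + (1 + t) * ((1 + t) * ((1 + t) * ((1 + t) * X)))
step-identity₂ = solve-∀

triangle-bound : ∀ {t} k {R : Fin (3 + k) → Fin (3 + k) → Set} (R? : ∀ i j → Dec (R i j)) → Complete R →
                 R (last-three k 0F) (last-three k 1F) → R (last-three k 1F) (last-three k 2F) →
                 R (last-three k 2F) (last-three k 0F) →
                 count (compatible? {2 + t} R?) + 2 * (1 + t) ^ k ≤ (3 + k) * (1 + t) ^ (2 + k) + (1 + t) ^ (3 + k)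
triangle-bound zero R? _ R01 R12 R20 = triangle-count R? R01 R12 R20
triangle-bound {t} (suc k) {R} R? complete R01 R12 R20 = begin
  count (compatible? R?) + 2 * s ^ (1 + k)                ≤⟨ +-monoˡ-≤ (2 * s ^ (1 + k)) (delete-vertex R? complete) ⟩
  (s * c + s ^ (3 + k)) + 2 * s ^ (1 + k)                 ≡⟨ step-identity₁ t c (s ^ k) ⟩
  s * (c + 2 * s ^ k) + s ^ (3 + k)                       ≤⟨ +-monoˡ-≤ (s ^ (3 + k)) (*-monoʳ-≤ s induction-hypothesis) ⟩
  s * ((3 + k) * s ^ (2 + k) + s ^ (3 + k)) + s ^ (3 + k) ≡⟨ step-identity₂ t k (s ^ k) ⟩
  (4 + k) * s ^ (3 + k) + s ^ (4 + k)                     ∎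
  where
    open ≤-Reasoning
    s c : ℕ
    s = 1 + t
    c = count (compatible? {2 + t} (delete₀? R?))
    induction-hypothesis : c + 2 * s ^ k ≤ (3 + k) * s ^ (2 + k) + s ^ (3 + k)
    induction-hypothesis = triangle-bound k (delete₀? R?)
      (λ i j i≢j → complete (suc i) (suc j) (λ e → i≢j (suc-injective e))) R01 R12 R20

transpose-here : ∀ {n} (i j : Fin n) → Transposition.transpose i j i ≡ j
transpose-here i j rewrite dec-true (i ≟ᶠ i) refl = refl

transpose-elsewhere : ∀ {n} {i j k : Fin n} → k ≢ i → k ≢ j → Transposition.transpose i j k ≡ k
transpose-elsewhere {i = i} {j} {k} k≢i k≢j rewrite dec-false (k ≟ᶠ i) k≢i | dec-false (k ≟ᶠ j) k≢j = refl

permutation-injective : ∀ {n} (π : Permutation′ n) → Injective _≡_ _≡_ (π ⟨$⟩ʳ_)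
permutation-injective π {x} {y} πx≡πy = trans (sym (inverseˡ π)) (trans (cong (π ⟨$⟩ˡ_) πx≡πy) (inverseˡ π))

-- Any injection Fin k → Fin n is carried onto any other one by a permutation of Fin n:
-- extend a permutation matching all but the first point by one transposition.
extend-to-permutation : ∀ {k n} (f g : Fin k → Fin n) → Injective _≡_ _≡_ f → Injective _≡_ _≡_ g →
                        Σ (Permutation′ n) λ π → ∀ i → π ⟨$⟩ʳ f i ≡ g i
extend-to-permutation {zero} f g _ _ = idₚ , λ ()
extend-to-permutation {suc k} f g f-inj g-inj with
  extend-to-permutation (f ∘ suc) (g ∘ suc) (λ e → suc-injective (f-inj e)) (λ e → suc-injective (g-inj e))
... | π , π-matches = π ∘ₚ transpose (π ⟨$⟩ʳ f zero) (g zero) , matches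
  where
    matches : ∀ i → Transposition.transpose (π ⟨$⟩ʳ f zero) (g zero) (π ⟨$⟩ʳ f i) ≡ g i
    matches zero    = transpose-here (π ⟨$⟩ʳ f zero) (g zero)
    matches (suc i) = trans (cong (Transposition.transpose (π ⟨$⟩ʳ f zero) (g zero)) (π-matches i))
      (transpose-elsewhere
        (λ e → 0≢1+n (sym (f-inj (permutation-injective π (trans (π-matches i) e)))))
        (λ e → 0≢1+n (sym (g-inj e))))

relabel : ∀ {q n} → Permutation′ n → Column q n → Column q n
relabel π v = tabulate (λ x → lookup v (π ⟨$⟩ʳ x))

relabel-inverse : ∀ {q n} (π : Permutation′ n) (v : Column q n) → relabel (flip π) (relabel π v) ≡ v
relabel-inverse π v = trans
  (tabulate-cong λ x → trans (lookup∘tabulate (λ y → lookup v (π ⟨$⟩ʳ y)) (π ⟨$⟩ˡ x)) (cong (lookup v) (inverseʳ π)))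
  (tabulate∘lookup v)

relabel-injective : ∀ {q n} (π : Permutation′ n) → Injective _≡_ _≡_ (relabel {q} π)
relabel-injective π {v} {w} πv≡πw =
  trans (sym (relabel-inverse π v)) (trans (cong (relabel (flip π)) πv≡πw) (relabel-inverse π w))

relabel-compatible : ∀ {q n} {R : Fin n → Fin n → Set} (π : Permutation′ n) {v : Column q n} →
                     Compatible R v → Compatible (R on (π ⟨$⟩ʳ_)) (relabel π v)
relabel-compatible π {v} compat x y Rπxπy (πv-x≡0 , πv-y≡1) = compat (π ⟨$⟩ʳ x) (π ⟨$⟩ʳ y) Rπxπy
  ( trans (cong toℕ (sym (lookup∘tabulate (λ z → lookup v (π ⟨$⟩ʳ z)) x))) πv-x≡0
  , trans (cong toℕ (sym (lookup∘tabulate (λ z → lookup v (π ⟨$⟩ʳ z)) y))) πv-y≡1 )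

Triangle : ∀ {n} → (Fin n → Fin n → Set) → Set
Triangle R = ∃ λ a → ∃ λ b → ∃ λ c → (a ≢ b × b ≢ c × a ≢ c) × (R a b × R b c × R c a)

triangle? : ∀ {n} {R : Fin n → Fin n → Set} → (∀ i j → Dec (R i j)) → Dec (Triangle R)
triangle? R? = any? λ a → any? λ b → any? λ c →
  (¬? (a ≟ᶠ b) ×-dec ¬? (b ≟ᶠ c) ×-dec ¬? (a ≟ᶠ c)) ×-dec (R? a b ×-dec R? b c ×-dec R? c a)

triangle-mono : ∀ {n} {R S : Fin n → Fin n → Set} → (∀ i j → R i j → S i j) → Triangle R → Triangle S
triangle-mono R⊆S (a , b , c , distinct , Rab , Rbc , Rca) = a , b , c , distinct , R⊆S a b Rab , R⊆S b c Rbc , R⊆S c a Rca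

triangle-free⇒transitive : ∀ {n} {T : Fin n → Fin n → Set} → IsTournament T → ¬ Triangle T → Transitive T
triangle-free⇒transitive {T = T} tournament no-triangle i j k Tij Tjk =
  Sum.fromInj₁ (λ Tki → ⊥-elim (no-triangle (i , j , k , (i≢j , j≢k , i≢k) , Tij , Tjk , Tki))) (total i k i≢k)
  where
    open IsTournament tournament
    i≢j : i ≢ j
    i≢j i≡j = irrefl i (subst (T i) (sym i≡j) Tij)
    j≢k : j ≢ k
    j≢k j≡k = irrefl j (subst (T j) (sym j≡k) Tjk)
    i≢k : i ≢ k
    i≢k i≡k = asym i j Tij (subst (T j) (sym i≡k) Tjk)

corners : ∀ {n} → Fin n → Fin n → Fin n → Fin 3 → Fin n
corners a b c 0F = a
corners a b c 1F = b
corners a b c 2F = c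

corners-injective : ∀ {n} {a b c : Fin n} → a ≢ b × b ≢ c × a ≢ c → Injective _≡_ _≡_ (corners a b c)
corners-injective _                 {0F} {0F} _ = refl
corners-injective _                 {1F} {1F} _ = refl
corners-injective _                 {2F} {2F} _ = refl
corners-injective (a≢b , _   , _  ) {0F} {1F} e = ⊥-elim (a≢b e)
corners-injective (_   , _   , a≢c) {0F} {2F} e = ⊥-elim (a≢c e)
corners-injective (a≢b , _   , _  ) {1F} {0F} e = ⊥-elim (a≢b (sym e))
corners-injective (_   , b≢c , _  ) {1F} {2F} e = ⊥-elim (b≢c e)
corners-injective (_   , _   , a≢c) {2F} {0F} e = ⊥-elim (a≢c (sym e))
corners-injective (_   , b≢c , _  ) {2F} {1F} e = ⊥-elim (b≢c (sym e))

last-three-injective : ∀ k → Injective _≡_ _≡_ (last-three k)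
last-three-injective zero    e = e
last-three-injective (suc k) e = last-three-injective k (suc-injective e)

-- Distinct words compatible with a complete decidable relation that contains a directed
-- triangle: move the triangle to the last three vertices, then count.
compatible-words-bound : ∀ {t} k {R : Fin (3 + k) → Fin (3 + k) → Set} (R? : ∀ i j → Dec (R i j)) →
  Complete R → Triangle R → (L : List (Column (2 + t) (3 + k))) → Unique L → (∀ {v} → v ∈ L → Compatible R v) →
  length L + 2 * (1 + t) ^ k ≤ (3 + k) * (1 + t) ^ (2 + k) + (1 + t) ^ (3 + k)
compatible-words-bound {t} k {R} R? complete (a , b , c , distinct , Rab , Rbc , Rca) L unique compatible
  with extend-to-permutation (last-three k) (corners a b c) (last-three-injective k) (corners-injective distinct)
... | π , places = begin
  length L + 2 * (1 + t) ^ k                       ≡⟨ cong (_+ 2 * (1 + t) ^ k) (sym (length-map (relabel π) L)) ⟩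
  length (map (relabel π) L) + 2 * (1 + t) ^ k     ≤⟨ +-monoˡ-≤ (2 * (1 + t) ^ k)
                                                        (unique⇒length≤count (compatible? Rπ?) (map (relabel π) L)
                                                          (Unique.map⁺ (relabel-injective π) unique) relabelled) ⟩
  count (compatible? Rπ?) + 2 * (1 + t) ^ k        ≤⟨ triangle-bound k Rπ? complete-π (edge 0F 1F Rab) (edge 1F 2F Rbc)
                                                        (edge 2F 0F Rca) ⟩
  (3 + k) * (1 + t) ^ (2 + k) + (1 + t) ^ (3 + k)  ∎
  where
    open ≤-Reasoning
    Rπ? : ∀ x y → Dec ((R on (π ⟨$⟩ʳ_)) x y)
    Rπ? x y = R? (π ⟨$⟩ʳ x) (π ⟨$⟩ʳ y)
    complete-π : Complete (R on (π ⟨$⟩ʳ_))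
    complete-π x y x≢y = complete (π ⟨$⟩ʳ x) (π ⟨$⟩ʳ y) (x≢y ∘ permutation-injective π)
    edge : ∀ i j → R (corners a b c i) (corners a b c j) → R (π ⟨$⟩ʳ last-three k i) (π ⟨$⟩ʳ last-three k j)
    edge i j = subst₂ R (sym (places i)) (sym (places j))
    relabelled : ∀ {w} → w ∈ map (relabel π) L → Compatible (R on (π ⟨$⟩ʳ_)) w
    relabelled w∈ with ∈-map⁻ (relabel π) w∈
    ... | v , v∈L , refl = relabel-compatible π {v} (compatible v∈L)

Permitted : ∀ {r m} → Matrix r m → Fin m → Fin m → Set
Permitted A i j = ¬ Σ (Fin (length A)) λ c → entry A i c ≡ 0 × entry A j c ≡ 1

permitted? : ∀ {r m} (A : Matrix r m) → ∀ i j → Dec (Permitted A i j)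
permitted? A i j = ¬? (any? λ c → (entry A i c ℕ.≟ 0) ×-dec (entry A j c ℕ.≟ 1))

columns-compatible : ∀ {r m} (A : Matrix r m) {v} → v ∈ A → Compatible (Permitted A) v
columns-compatible A {v} v∈A i j permitted (vi≡0 , vj≡1) = permitted
  ( index v∈A
  , subst (λ w → toℕ (lookup w i) ≡ 0) (lookup-index v∈A) vi≡0
  , subst (λ w → toℕ (lookup w j) ≡ 1) (lookup-index v∈A) vj≡1 )

-- Proposition 4.2.  The columns of A are distinct words compatible with Permitted A;
-- this relation is complete since it contains T, and it has a directed triangle since
-- otherwise T would be transitive.
proposition4p2 : (r m : ℕ) → 2 ≤ r → 3 ≤ m →
  (A : Matrix r m) → Simple A → AvoidsI₂ A →
  (T : Fin m → Fin m → Set) → IsAssociatedTournament A T →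
  ¬ Transitive T →
  ncols A ≤ (m * (r ∸ 1) ^ (m ∸ 1) + (r ∸ 1) ^ m) ∸ 2 * (r ∸ 1) ^ (m ∸ 3)
proposition4p2 (suc (suc t)) (suc (suc (suc k))) (s≤s (s≤s z≤n)) (s≤s (s≤s (s≤s z≤n)))
               A simple _ _ (tournament , T⊆permitted) intransitive =
  m+n≤o⇒m≤o∸n (length A)
    (compatible-words-bound k (permitted? A) complete triangle A simple (columns-compatible A))
  where
    complete : Complete (Permitted A)
    complete i j i≢j = Sum.map (T⊆permitted i j) (T⊆permitted j i) (IsTournament.total tournament i j i≢j)
    triangle : Triangle (Permitted A)
    triangle with triangle? (permitted? A)
    ... | yes permitted-triangle = permitted-triangle
    ... | no  no-triangle        =
      ⊥-elim (intransitive (triangle-free⇒transitive tournament (no-triangle ∘ triangle-mono T⊆permitted)))
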